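{- Let $k\geq 1$ and let $G$ be a graph with $\delta(G)\geq k-1$. Suppose that $(d_{\times k}(G),d_{\times k,t}(G))\neq(2,1)$, i.e. either $d_{\times k}(G)\neq 2$, or $\delta(G)\geq k$ and $d_{\times k,t}(G)\neq 1$. Then $d_{\times k}^{r}(G)=d_{\times k}(G)$.
   Context: All graphs are finite, simple and undirected. For $G=(V,E)$ and $x\in V$, $N(x)$ is the open and $N[x]=N(x)\cup\{x\}$ the closed neighborhood. For $\delta(G)\geq k-1$: $S\subseteq V$ is a $k$-tuple dominating set if $|N[x]\cap S|\geq k$ for all $x\in V$; it is a $k$-tuple restrained dominating set if moreover every vertex of $V-S$ has at least $k$ neighbors in $V-S$. For $\delta(G)\geq k$: $S$ is a $k$-tuple total dominating set if $|N(x)\cap S|\geq k$ for all $x\in V$. The $k$-tuple domatic number $d_{\times k}(G)$ (resp. $k$-tuple restrained domatic number $d_{\times k}^{r}(G)$; $k$-tuple total domatic number $d_{\times k,t}(G)$, defined when $\delta(G)\geq k$) is the maximum number of classes of a partition of $V$ all of whose classes are $k$-tuple dominating sets (resp. $k$-tuple restrained dominating sets; $k$-tuple total dominating sets). -}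

module Defs where

open import Data.Nat using (ℕ; _≤_; _∸_; _+_)
open import Data.Bool using (Bool; true; false; if_then_else_; _∧_; _∨_; not)
open import Data.Fin using (Fin; _≟_)
open import Data.List using (List; map; allFin)
open import Data.Nat.ListAction using (sum)
open import Data.Product using (Σ; _×_; ∃)
open import Relation.Binary.PropositionalEquality using (_≡_)
open import Relation.Nullary.Decidable using (⌊_⌋)
open import Function.Definitions using (Surjective)

record Graph (n : ℕ) : Set where
  field
    adj   : Fin n → Fin n → Bool
    sym   : ∀ x y → adj x y ≡ adj y x
    irrefl : ∀ x → adj x x ≡ false
open Graph public

VSet : ℕ → Set
VSet n = Fin n → Bool

count : ∀ {n} → (Fin n → Bool) → ℕ
count {n} p = sum (map (λ y → if p y then 1 else 0) (allFin n))

N : ∀ {n} → Graph n → Fin n → VSet n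
N G x y = adj G x y

N[_,_] : ∀ {n} → Graph n → Fin n → VSet n
N[ G , x ] y = ⌊ y ≟ x ⌋ ∨ adj G x y

deg : ∀ {n} → Graph n → Fin n → ℕ
deg G x = count (N G x)

MinDegGE : ∀ {n} → Graph n → ℕ → Set
MinDegGE G d = ∀ x → d ≤ deg G x

∣_∩_∣ : ∀ {n} → VSet n → VSet n → ℕ
∣ A ∩ S ∣ = count (λ y → A y ∧ S y)

IsKTupleDom : ∀ {n} → Graph n → ℕ → VSet n → Set
IsKTupleDom G k S = ∀ x → k ≤ ∣ N[ G , x ] ∩ S ∣

IsKTupleRestrainedDom : ∀ {n} → Graph n → ℕ → VSet n → Set
IsKTupleRestrainedDom G k S =
  IsKTupleDom G k S × (∀ x → S x ≡ false → k ≤ ∣ N G x ∩ (λ y → not (S y)) ∣)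

IsKTupleTotalDom : ∀ {n} → Graph n → ℕ → VSet n → Set
IsKTupleTotalDom G k S = ∀ x → k ≤ ∣ N G x ∩ S ∣

cls : ∀ {n m} → (Fin n → Fin m) → Fin m → VSet n
cls c i y = ⌊ c y ≟ i ⌋

PartitionInto : ∀ {n} → (VSet n → Set) → ℕ → Set
PartitionInto {n} P m =
  Σ (Fin n → Fin m) λ c → Surjective _≡_ _≡_ c × (∀ i → P (cls c i))

IsMaxPartitionNumber : ∀ {n} → (VSet n → Set) → ℕ → Set
IsMaxPartitionNumber P d = PartitionInto P d × (∀ m → PartitionInto P m → m ≤ d)

IsKTupleDomaticNumber : ∀ {n} → Graph n → ℕ → ℕ → Set
IsKTupleDomaticNumber G k d = IsMaxPartitionNumber (IsKTupleDom G k) d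

IsKTupleRestrainedDomaticNumber : ∀ {n} → Graph n → ℕ → ℕ → Set
IsKTupleRestrainedDomaticNumber G k d = IsMaxPartitionNumber (IsKTupleRestrainedDom G k) d

IsKTupleTotalDomaticNumber : ∀ {n} → Graph n → ℕ → ℕ → Set
IsKTupleTotalDomaticNumber G k d = IsMaxPartitionNumber (IsKTupleTotalDom G k) d

-- Every k-tuple restrained dominating set is k-tuple dominating, so dr ≤ d. Conversely, in a
-- k-tuple domatic partition with d ≠ 2 classes every class is restrained: for x outside class i
-- some third class j avoids both x and class i, and the k vertices of class j dominating x are
-- neighbours of x outside class i (for d = 1 no vertex lies outside the class). For d = 2, a
-- k-tuple total domatic partition with at least two classes, merged into two halves, is a
-- restrained domatic partition: every vertex has k neighbours in a total class inside each half.
module Submission where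

open import Defs hiding (sym)
open import Data.Nat using (ℕ; _≤_; _∸_; zero; suc; z≤n) renaming (_≟_ to _≟ℕ_)
open import Data.Nat.Properties using (≤-refl; ≤-trans; ≤-antisym; +-mono-≤)
open import Data.Nat.ListAction using (sum)
open import Data.Bool using (true; false; if_then_else_; _∧_; _∨_; not)
open import Data.Bool.Properties using (∧-conicalˡ; ∧-conicalʳ; ∨-zeroʳ)
open import Data.Fin using (Fin; _≟_; punchIn; punchOut) renaming (zero to fzero; suc to fsuc)
open import Data.Fin.Properties using (punchInᵢ≢i; punchIn-injective; punchIn-punchOut)
open import Data.List using (List; []; _∷_; map; allFin)
open import Data.Product using (Σ; ∃-syntax; _×_; _,_; proj₁)
open import Data.Sum as Sum using (_⊎_; inj₁; inj₂)
open import Function using (_∘_; id; case_of_)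
open import Function.Definitions using (Surjective)
import Function.Construct.Composition as Composition
open import Relation.Nullary using (yes; no; contradiction)
open import Relation.Nullary.Decidable using (⌊_⌋)
open import Relation.Binary.PropositionalEquality using (_≡_; _≢_; refl; sym; trans; cong; cong₂)

private
  variable
    n m m′ k : ℕ

_⊆_ : VSet n → VSet n → Set
A ⊆ B = ∀ y → A y ≡ true → B y ≡ true

⊆-refl : {A : VSet n} → A ⊆ A
⊆-refl _ y∈A = y∈A

∁ : VSet n → VSet n
∁ S y = not (S y)

count-mono : {A B : VSet n} → A ⊆ B → count A ≤ count B
count-mono {n} {A} {B} A⊆B = go (allFin n)
  where
  indicator-mono : ∀ y → (if A y then 1 else 0) ≤ (if B y then 1 else 0)
  indicator-mono y with A y in y∈A
  ... | false = z≤n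
  ... | true rewrite A⊆B y y∈A = ≤-refl
  go : (ys : List (Fin n)) →
       sum (map (λ y → if A y then 1 else 0) ys) ≤ sum (map (λ y → if B y then 1 else 0) ys)
  go []       = z≤n
  go (y ∷ ys) = +-mono-≤ (indicator-mono y) (go ys)

∩-mono : {A A′ S S′ : VSet n} → A ⊆ A′ → S ⊆ S′ → ∣ A ∩ S ∣ ≤ ∣ A′ ∩ S′ ∣
∩-mono A⊆A′ S⊆S′ = count-mono λ y h →
  cong₂ _∧_ (A⊆A′ y (∧-conicalˡ _ _ h)) (S⊆S′ y (∧-conicalʳ _ _ h))

N⊆N[] : (G : Graph n) (x : Fin n) → N G x ⊆ N[ G , x ]
N⊆N[] G x y y∈N = trans (cong (⌊ y ≟ x ⌋ ∨_) y∈N) (∨-zeroʳ ⌊ y ≟ x ⌋)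

∣N[]∩∣≤∣N∩∣ : (G : Graph n) {S : VSet n} {x : Fin n} →
              S x ≡ false → ∣ N[ G , x ] ∩ S ∣ ≤ ∣ N G x ∩ S ∣
∣N[]∩∣≤∣N∩∣ G {S} {x} x∉S = count-mono drop-x
  where
  drop-x : (λ y → N[ G , x ] y ∧ S y) ⊆ (λ y → N G x y ∧ S y)
  drop-x y h with y ≟ x
  ... | yes refl = case trans (sym x∉S) h of λ ()
  ... | no _     = h

dom-mono : (G : Graph n) {S T : VSet n} → IsKTupleDom G k S → S ⊆ T → IsKTupleDom G k T
dom-mono G S-dom S⊆T x = ≤-trans (S-dom x) (∩-mono ⊆-refl S⊆T)

totalDom⇒dom : (G : Graph n) {S : VSet n} → IsKTupleTotalDom G k S → IsKTupleDom G k S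
totalDom⇒dom G S-total x = ≤-trans (S-total x) (∩-mono (N⊆N[] G x) ⊆-refl)

dom⇒neighbours-outside : (G : Graph n) {S : VSet n} → IsKTupleDom G k S →
                         {x : Fin n} → S x ≡ false → k ≤ ∣ N G x ∩ S ∣
dom⇒neighbours-outside G S-dom {x} x∉S = ≤-trans (S-dom x) (∣N[]∩∣≤∣N∩∣ G x∉S)

restrained-intro : (G : Graph n) {S : VSet n} → IsKTupleDom G k S →
                   (∀ x → S x ≡ false → ∃[ D ] D ⊆ ∁ S × k ≤ ∣ N G x ∩ D ∣) →
                   IsKTupleRestrainedDom G k S
restrained-intro G S-dom outside = S-dom , λ x x∉S →
  let (D , D⊆∁S , k≤∣N∩D∣) = outside x x∉S in ≤-trans k≤∣N∩D∣ (∩-mono ⊆-refl D⊆∁S)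

cls-∋ : (c : Fin n → Fin m) {i : Fin m} {y : Fin n} → c y ≡ i → cls c i y ≡ true
cls-∋ c {i} {y} cy≡i with c y ≟ i
... | yes _    = refl
... | no cy≢i = contradiction cy≡i cy≢i

cls-∌ : (c : Fin n → Fin m) {i : Fin m} {y : Fin n} → c y ≢ i → cls c i y ≡ false
cls-∌ c {i} {y} cy≢i with c y ≟ i
... | yes cy≡i = contradiction cy≡i cy≢i
... | no _     = refl

∈cls⇒ : (c : Fin n → Fin m) {i : Fin m} {y : Fin n} → cls c i y ≡ true → c y ≡ i
∈cls⇒ c {i} {y} y∈i with c y ≟ i
... | yes cy≡i = cy≡i

∉cls⇒ : (c : Fin n → Fin m) {i : Fin m} {y : Fin n} → cls c i y ≡ false → c y ≢ i
∉cls⇒ c y∉i cy≡i = case trans (sym y∉i) (cls-∋ c cy≡i) of λ ()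

cls⊆merged : (c : Fin n → Fin m) (f : Fin m → Fin m′) {i : Fin m′} {j : Fin m} →
             f j ≡ i → cls c j ⊆ cls (f ∘ c) i
cls⊆merged c f fj≡i y y∈j = cls-∋ (f ∘ c) (trans (cong f (∈cls⇒ c y∈j)) fj≡i)

cls⊆∁merged : (c : Fin n → Fin m) (f : Fin m → Fin m′) {i : Fin m′} {j : Fin m} →
              f j ≢ i → cls c j ⊆ ∁ (cls (f ∘ c) i)
cls⊆∁merged c f fj≢i y y∈j =
  cong not (cls-∌ (f ∘ c) (fj≢i ∘ trans (cong f (sym (∈cls⇒ c y∈j)))))

avoid-pair : m ≢ 2 → (a b : Fin m) → a ≢ b → ∃[ j ] j ≢ a × j ≢ b
avoid-pair {suc zero}          _   fzero fzero a≢b = contradiction refl a≢b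
avoid-pair {suc (suc zero)}    m≢2 _     _     _   = contradiction refl m≢2
avoid-pair {suc (suc (suc m))} _   a     b     a≢b = j , punchInᵢ≢i a _ , j≢b
  where
  -- the first element of Fin m once b and then a are punched out
  b′ = punchOut a≢b
  j  = punchIn a (punchIn b′ fzero)
  j≢b : j ≢ b
  j≢b j≡b = punchInᵢ≢i b′ fzero
    (punchIn-injective a _ _ (trans j≡b (sym (punchIn-punchOut a≢b))))

restrainedPartition⇒domPartition : (G : Graph n) →
  PartitionInto (IsKTupleRestrainedDom G k) m → PartitionInto (IsKTupleDom G k) m
restrainedPartition⇒domPartition G (c , c-surj , restrained) =
  c , c-surj , proj₁ ∘ restrained

domPartition⇒restrainedPartition : (G : Graph n) → m ≢ 2 →
  PartitionInto (IsKTupleDom G k) m → PartitionInto (IsKTupleRestrainedDom G k) m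
domPartition⇒restrainedPartition G m≢2 (c , c-surj , dom) =
  c , c-surj , λ i → restrained-intro G (dom i) (outside i)
  where
  outside : ∀ i x → cls c i x ≡ false → ∃[ D ] D ⊆ ∁ (cls c i) × _ ≤ ∣ N G x ∩ D ∣
  outside i x x∉i =
    let (j , j≢i , j≢cx) = avoid-pair m≢2 i (c x) (∉cls⇒ c x∉i ∘ sym)
    in cls c j , cls⊆∁merged c id j≢i , dom⇒neighbours-outside G (dom j) (cls-∌ c (j≢cx ∘ sym))

mergedTotalPartition⇒restrainedPartition : (G : Graph n) (f : Fin m → Fin m′) →
  Surjective _≡_ _≡_ f → (∀ i → ∃[ j ] f j ≢ i) →
  PartitionInto (IsKTupleTotalDom G k) m → PartitionInto (IsKTupleRestrainedDom G k) m′
mergedTotalPartition⇒restrainedPartition G f f-surj f-nonconst (c , c-surj , total) =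
  f ∘ c , Composition.surjective _≡_ _≡_ _≡_ c-surj f-surj ,
  λ i → restrained-intro G (dom i) (outside i)
  where
  dom : ∀ i → IsKTupleDom G _ (cls (f ∘ c) i)
  dom i = let (j , fj≡i) = f-surj i
          in dom-mono G (totalDom⇒dom G (total j)) (cls⊆merged c f (fj≡i refl))
  outside : ∀ i x → cls (f ∘ c) i x ≡ false → ∃[ D ] D ⊆ ∁ (cls (f ∘ c) i) × _ ≤ ∣ N G x ∩ D ∣
  outside i x _ = let (j , fj≢i) = f-nonconst i in cls c j , cls⊆∁merged c f fj≢i , total j x

halves : Fin (suc (suc m)) → Fin 2
halves fzero    = fzero
halves (fsuc _) = fsuc fzero

halves-surjective : Surjective _≡_ _≡_ (halves {m})
halves-surjective fzero        = fzero , λ { refl → refl }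
halves-surjective (fsuc fzero) = fsuc fzero , λ { refl → refl }

halves-nonconstant : (i : Fin 2) → ∃[ j ] halves {m} j ≢ i
halves-nonconstant fzero        = fsuc fzero , λ ()
halves-nonconstant (fsuc fzero) = fzero , λ ()

totalPartition⇒restrainedPartition₂ : (G : Graph n) → Fin n → m ≢ 1 →
  PartitionInto (IsKTupleTotalDom G k) m → PartitionInto (IsKTupleRestrainedDom G k) 2
totalPartition⇒restrainedPartition₂ {m = zero}          G x _   (c , _) = case c x of λ ()
totalPartition⇒restrainedPartition₂ {m = suc zero}      G _ m≢1 _       = contradiction refl m≢1
totalPartition⇒restrainedPartition₂ {m = suc (suc _)}   G _ _   total   =
  mergedTotalPartition⇒restrainedPartition G halves halves-surjective halves-nonconstant total

domPartition⇒restrainedPartition′ : (G : Graph n) → PartitionInto (IsKTupleDom G k) m →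
  m ≢ 2 ⊎ (∃[ dt ] PartitionInto (IsKTupleTotalDom G k) dt × dt ≢ 1) →
  PartitionInto (IsKTupleRestrainedDom G k) m
domPartition⇒restrainedPartition′ G dom (inj₁ m≢2) = domPartition⇒restrainedPartition G m≢2 dom
domPartition⇒restrainedPartition′ {m = m} G dom@(c , c-surj , _) (inj₂ (_ , total , dt≢1))
  with m ≟ℕ 2
... | no m≢2  = domPartition⇒restrainedPartition G m≢2 dom
... | yes refl = totalPartition⇒restrainedPartition₂ G (proj₁ (c-surj fzero)) dt≢1 total

theorem4p5 : (k : ℕ) → 1 ≤ k → (n : ℕ) → (G : Graph n) → MinDegGE G (k ∸ 1) →
    (d dr : ℕ) → IsKTupleDomaticNumber G k d → IsKTupleRestrainedDomaticNumber G k dr →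
    (d ≢ 2 ⊎ (MinDegGE G k × Σ ℕ (λ dt → IsKTupleTotalDomaticNumber G k dt × dt ≢ 1))) →
    dr ≡ d
theorem4p5 k _ n G _ d dr (dom-d , d-max) (restrained-dr , dr-max) hyp =
  ≤-antisym (d-max dr (restrainedPartition⇒domPartition G restrained-dr))
            (dr-max d (domPartition⇒restrainedPartition′ G dom-d (Sum.map₂ forget-maximality hyp)))
  where
  forget-maximality : MinDegGE G k × Σ ℕ (λ dt → IsKTupleTotalDomaticNumber G k dt × dt ≢ 1) →
                      ∃[ dt ] PartitionInto (IsKTupleTotalDom G k) dt × dt ≢ 1
  forget-maximality (_ , dt , (total , _) , dt≢1) = dt , total , dt≢1
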